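{- Let $X$ be a finite simplicial complex with vertices $v_1,\dots,v_m$, let $\varepsilon,\varepsilon'\in\mathbb{Z}_2^m$ be colourings that differ only at the index of a vertex $v$, with $v$ white in $\varepsilon$ and black in $\varepsilon'$. Let $x=\sum_{r=1}^p\sigma_r$ (distinct simplices $\sigma_r$) be a cycle, homogeneous in bidegree, in $(C(X),\partial_h^{\varepsilon})$. Then $x$ is a cycle in $(C(X),\partial_h^{\varepsilon'})$ if and only if $v$ does not belong to $\bigcup_{r=1}^pV(\sigma_r)$.
   Context: $\mathbb{F}$ is the field with two elements and $C(X)$ is the simplicial chain complex of $X$ over $\mathbb{F}$. A colouring $\varepsilon\in\mathbb{Z}_2^m$ colours $v_i$ black if $\varepsilon(i)=1$ and white otherwise; the weight of a simplex is its number of white vertices. The horizontal differential $\partial_h^{\varepsilon}$ sends a simplex $\sigma$ to the sum of the faces $\sigma\setminus\{w\}$ over the black (with respect to $\varepsilon$) vertices $w\in\sigma$. $C(X)$ is bigraded by (dimension, weight), and "homogeneous" means all $\sigma_r$ have the same dimension and the same $\varepsilon$-weight. $V(\sigma)$ is the vertex set of $\sigma$. -}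

module Defs where

open import Data.Bool using (Bool; true; false; _∧_; not)
import Data.Bool.Properties as BoolP
open import Data.Nat using (ℕ; _%_)
open import Data.Fin using (Fin)
open import Data.Fin.Subset using (Subset; _∈_; _⊆_; ⁅_⁆; ∣_∣) renaming (⊥ to ∅)
open import Data.Vec using (Vec; lookup; _[_]≔_)
import Data.Vec.Properties as VecP
open import Data.List using (List; []; _∷_; filter; length; map; concatMap; allFin)
open import Data.List.Membership.Propositional using () renaming (_∈_ to _∈ₗ_)
open import Data.List.Relation.Unary.All using (All)
open import Data.Product using (_×_)
open import Relation.Nullary using (Dec)
open import Relation.Binary.PropositionalEquality using (_≡_)

Simplex : ℕ → Set
Simplex m = Subset m

_≟ₛ_ : ∀ {m} (σ τ : Simplex m) → Dec (σ ≡ τ)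
_≟ₛ_ = VecP.≡-dec BoolP._≟_

record SimplicialComplex (m : ℕ) : Set₁ where
  field
    Face       : Simplex m → Set
    down-closed : ∀ {σ τ} → τ ⊆ σ → Face σ → Face τ
    empty-face : Face ∅
    vertex-face : ∀ i → Face ⁅ i ⁆

-- Colouring: ε(i) = true (=1) means v_i is black, false means white.
Colouring : ℕ → Set
Colouring m = Vec Bool m

weight : ∀ {m} → Colouring m → Simplex m → ℕ
weight {m} ε σ = length (filter (λ i → BoolP.T? (lookup σ i ∧ not (lookup ε i))) (allFin m))

-- A chain over F_2, written as a list of simplices (formal sum).
Chain : ℕ → Set
Chain m = List (Simplex m)

∂h-simplex : ∀ {m} → Colouring m → Simplex m → Chain m
∂h-simplex {m} ε σ =
  map (λ w → σ [ w ]≔ false)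
      (filter (λ i → BoolP.T? (lookup σ i ∧ lookup ε i)) (allFin m))

∂h : ∀ {m} → Colouring m → Chain m → Chain m
∂h ε x = concatMap (∂h-simplex ε) x

count : ∀ {m} → Simplex m → Chain m → ℕ
count τ x = length (filter (τ ≟ₛ_) x)

IsZero : ∀ {m} → Chain m → Set
IsZero x = ∀ τ → count τ x % 2 ≡ 0

IsCycle : ∀ {m} → Colouring m → Chain m → Set
IsCycle ε x = IsZero (∂h ε x)

InComplex : ∀ {m} → SimplicialComplex m → Chain m → Set
InComplex X x = All (SimplicialComplex.Face X) x

Homogeneous : ∀ {m} → Colouring m → Chain m → Set
Homogeneous ε x = ∀ {σ τ} → σ ∈ₗ x → τ ∈ₗ x → (∣ σ ∣ ≡ ∣ τ ∣) × (weight ε σ ≡ weight ε τ)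

-- Recolouring v from white to black adds, for every simplex σ ∋ v, exactly one new term σ ∖ v
-- to its horizontal boundary, so ∂′x = ∂x + Σ_{v ∈ σ ∈ x} (σ ∖ v).  As x is an ε-cycle, x is an
-- ε′-cycle iff the last sum vanishes over 𝔽₂.  Since σ ↦ σ ∖ v is injective on simplices
-- containing v and the σ are distinct, that sum has no cancellation: it vanishes iff it is empty.
module Submission where

open import Defs
open import Data.Bool using (true; false; T; _∧_)
open import Data.Bool.Properties using (T?; T-∧; T-≡)
open import Data.Empty using (⊥-elim)
open import Data.Nat using (ℕ; _+_; _%_)
open import Data.Nat.DivMod using (%-distribˡ-+; m%n%n≡m%n)
open import Data.Nat.Properties using (+-identityʳ)
open import Data.Fin using (Fin) renaming (_≟_ to _≟ᶠ_)
open import Data.Fin.Subset using (_∈_; _∉_)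
open import Data.Fin.Subset.Properties using (_∈?_)
open import Data.Vec using (lookup; _[_]≔_)
open import Data.Vec.Properties using ([]=⇒lookup; lookup⇒[]=; []≔-idempotent; []≔-lookup)
open import Data.List using ([]; _∷_; _++_; filter; length; map; allFin)
open import Data.List.Properties using (filter-accept; filter-reject; filter-none; filter-≐; filter-++; length-++)
open import Data.List.Relation.Unary.Any using (Any; here; there)
open import Data.List.Relation.Unary.All as All using (All; []; _∷_)
open import Data.List.Relation.Unary.AllPairs using ([]; _∷_)
open import Data.List.Relation.Unary.All.Properties using (¬Any⇒All¬; all-filter) renaming (map⁺ to All-map⁺)
open import Data.List.Relation.Unary.Unique.Propositional using (Unique)
open import Data.List.Relation.Unary.Unique.Propositional.Properties using (allFin⁺) renaming (filter⁺ to Unique-filter⁺)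
open import Data.List.Membership.Propositional using (find) renaming (_∈_ to _∈ₗ_)
open import Data.List.Membership.Propositional.Properties using (∈-allFin; ∈-map⁺; ∈-filter⁺)
open import Data.List.Relation.Binary.Permutation.Propositional using (_↭_; ↭-refl; ↭-sym; ↭-trans; ↭-reflexive; prep)
open import Data.List.Relation.Binary.Permutation.Propositional.Properties using (filter-↭; ↭-length; map⁺; ++⁺; shift; shifts)
open import Data.Product using (_,_; proj₁; proj₂)
open import Function using (_∘_)
open import Function.Bundles using (_⇔_; mk⇔; Equivalence)
open import Function.Properties.Equivalence using () renaming (trans to ⇔-trans)
open import Relation.Binary.Definitions using (DecidableEquality)
open import Relation.Binary.PropositionalEquality using (_≡_; _≢_; refl; sym; trans; cong; subst)
open import Relation.Nullary using (¬_; yes; no; contradiction)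
open import Relation.Unary using (Pred; Decidable)

T-∧-monoʳ : ∀ {a b c} → (T b → T c) → T (a ∧ b) → T (a ∧ c)
T-∧-monoʳ {true} b⇒c = b⇒c

module _ {A : Set} (_≟_ : DecidableEquality A) where

  filter-≟-unique : ∀ {a xs} → Unique xs → a ∈ₗ xs → filter (a ≟_) xs ≡ a ∷ []
  filter-≟-unique (a∉xs ∷ _) (here refl) =
    trans (filter-accept (_ ≟_) refl) (cong (_ ∷_) (filter-none (_ ≟_) a∉xs))
  filter-≟-unique (x∉xs ∷ u) (there a∈xs) =
    trans (filter-reject (_ ≟_) (λ a≡x → All.lookup x∉xs a∈xs (sym a≡x))) (filter-≟-unique u a∈xs)

  filter-add-point : ∀ {p q} {P : Pred A p} {Q : Pred A q} (P? : Decidable P) (Q? : Decidable Q) {v}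
    → (∀ {a} → P a → Q a) → (∀ {a} → a ≢ v → Q a → P a) → ¬ P v → Q v
    → ∀ xs → filter Q? xs ↭ filter (v ≟_) xs ++ filter P? xs
  filter-add-point P? Q? P⇒Q Q⇒P ¬Pv Qv [] = ↭-refl
  filter-add-point P? Q? {v} P⇒Q Q⇒P ¬Pv Qv (x ∷ xs)
    with ih ← filter-add-point P? Q? P⇒Q Q⇒P ¬Pv Qv xs | v ≟ x | Q? x | P? x
  ... | yes refl | no ¬Qv  | _      = contradiction Qv ¬Qv
  ... | yes refl | yes _   | yes Pv = contradiction Pv ¬Pv
  ... | yes refl | yes _   | no _   = prep v ih
  ... | no v≢x   | yes Qx  | no ¬Px = contradiction (Q⇒P (v≢x ∘ sym) Qx) ¬Px
  ... | no _     | no ¬Qx  | yes Px = contradiction (P⇒Q Px) ¬Qx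
  ... | no _     | no _    | no _   = ih
  ... | no _     | yes _   | yes _  =
    ↭-trans (prep x ih) (↭-sym (shift x (filter (v ≟_) xs) (filter P? xs)))

module _ {a b p} {A : Set a} {B : Set b} {P : Pred A p} (f : A → B) where

  Unique-map⁺-on : (∀ {x y} → P x → P y → f x ≡ f y → x ≡ y)
    → ∀ {xs} → All P xs → Unique xs → Unique (map f xs)
  Unique-map⁺-on inj [] [] = []
  Unique-map⁺-on inj (Px ∷ Pxs) (x∉xs ∷ u) =
    All-map⁺ (All.tabulate λ y∈xs fx≡fy →
      All.lookup x∉xs y∈xs (inj Px (All.lookup Pxs y∈xs) fx≡fy))
    ∷ Unique-map⁺-on inj Pxs u

module _ {m : ℕ} where

  T-lookup⇒∈ : ∀ {σ : Simplex m} {i} → T (lookup σ i) → i ∈ σ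
  T-lookup⇒∈ {σ} {i} t = lookup⇒[]= i σ (Equivalence.to T-≡ t)

  count-++ : ∀ (τ : Simplex m) xs ys → count τ (xs ++ ys) ≡ count τ xs + count τ ys
  count-++ τ xs ys = trans (cong length (filter-++ (τ ≟ₛ_) xs ys)) (length-++ (filter (τ ≟ₛ_) xs))

  count-resp-↭ : ∀ (τ : Simplex m) {xs ys} → xs ↭ ys → count τ xs ≡ count τ ys
  count-resp-↭ τ = ↭-length ∘ filter-↭ (τ ≟ₛ_)

  count-unique : ∀ {σ : Simplex m} {xs} → Unique xs → σ ∈ₗ xs → count σ xs ≡ 1
  count-unique u σ∈xs = cong length (filter-≟-unique _≟ₛ_ u σ∈xs)

  IsZero-resp-↭ : ∀ {xs ys : Chain m} → xs ↭ ys → IsZero xs → IsZero ys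
  IsZero-resp-↭ p z τ = trans (cong (_% 2) (sym (count-resp-↭ τ p))) (z τ)

  %2-absorbʳ : ∀ a b → b % 2 ≡ 0 → (a + b) % 2 ≡ a % 2
  %2-absorbʳ a b b%2≡0 = begin
    (a + b) % 2             ≡⟨ %-distribˡ-+ a b 2 ⟩
    (a % 2 + b % 2) % 2     ≡⟨ cong (λ r → (a % 2 + r) % 2) b%2≡0 ⟩
    (a % 2 + 0) % 2         ≡⟨ cong (_% 2) (+-identityʳ (a % 2)) ⟩
    a % 2 % 2               ≡⟨ m%n%n≡m%n a 2 ⟩
    a % 2                   ∎
    where open Relation.Binary.PropositionalEquality.≡-Reasoning

  IsZero-++ʳ : ∀ (xs : Chain m) ys → IsZero ys → IsZero (xs ++ ys) ⇔ IsZero xs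
  IsZero-++ʳ xs ys z = mk⇔
    (λ z′ τ → trans (sym (same-parity τ)) (z′ τ))
    (λ z′ τ → trans (same-parity τ) (z′ τ))
    where
    same-parity : ∀ τ → count τ (xs ++ ys) % 2 ≡ count τ xs % 2
    same-parity τ = trans (cong (_% 2) (count-++ τ xs ys)) (%2-absorbʳ (count τ xs) (count τ ys) (z τ))

  unique-nonempty⇒¬IsZero : ∀ {σ : Simplex m} {xs} → Unique xs → σ ∈ₗ xs → ¬ IsZero xs
  unique-nonempty⇒¬IsZero {σ} u σ∈xs z with () ← trans (sym (cong (_% 2) (count-unique u σ∈xs))) (z σ)

  module _ (v : Fin m) where

    delete : Simplex m → Simplex m
    delete σ = σ [ v ]≔ false

    deleteVertex : Chain m → Chain m
    deleteVertex x = map delete (filter (v ∈?_) x)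

    delete-injective : ∀ {σ τ} → v ∈ σ → v ∈ τ → delete σ ≡ delete τ → σ ≡ τ
    delete-injective {σ} {τ} v∈σ v∈τ eq = begin
      σ                       ≡⟨ reinsert v∈σ ⟩
      delete σ [ v ]≔ true    ≡⟨ cong (_[ v ]≔ true) eq ⟩
      delete τ [ v ]≔ true    ≡⟨ reinsert v∈τ ⟨
      τ                       ∎
      where
      open Relation.Binary.PropositionalEquality.≡-Reasoning
      reinsert : ∀ {ρ} → v ∈ ρ → ρ ≡ delete ρ [ v ]≔ true
      reinsert {ρ} v∈ρ = begin
        ρ                       ≡⟨ []≔-lookup ρ v ⟨
        ρ [ v ]≔ lookup ρ v     ≡⟨ cong (ρ [ v ]≔_) ([]=⇒lookup v∈ρ) ⟩
        ρ [ v ]≔ true           ≡⟨ []≔-idempotent ρ v ⟨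
        delete ρ [ v ]≔ true    ∎

    IsZero-deleteVertex : ∀ x → Unique x → IsZero (deleteVertex x) ⇔ (¬ Any (v ∈_) x)
    IsZero-deleteVertex x u = mk⇔
      (λ z v∈x → let σ , σ∈x , v∈σ = find v∈x in
        unique-nonempty⇒¬IsZero
          (Unique-map⁺-on delete delete-injective (all-filter (v ∈?_) x) (Unique-filter⁺ (v ∈?_) u))
          (∈-map⁺ delete (∈-filter⁺ (v ∈?_) σ∈x v∈σ)) z)
      (λ v∉x τ → cong (λ ys → count τ (map delete ys) % 2) (filter-none (v ∈?_) (¬Any⇒All¬ x v∉x)))

module Recolouring {m : ℕ} (ε ε′ : Colouring m) (v : Fin m)
  (ε[v]≡false : lookup ε v ≡ false) (ε′[v]≡true : lookup ε′ v ≡ true)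
  (agree : ∀ i → i ≢ v → lookup ε i ≡ lookup ε′ i) where

  black-stays-black : ∀ {i} → T (lookup ε i) → T (lookup ε′ i)
  black-stays-black {i} t with i ≟ᶠ v
  ... | yes refl = ⊥-elim (subst T ε[v]≡false t)
  ... | no i≢v   = subst T (agree i i≢v) t

  black-was-black : ∀ {i} → i ≢ v → T (lookup ε′ i) → T (lookup ε i)
  black-was-black {i} i≢v = subst T (sym (agree i i≢v))

  module _ (σ : Simplex m) where

    BlackIn? : (κ : Colouring m) → Decidable (λ i → T (lookup σ i ∧ lookup κ i))
    BlackIn? κ i = T? (lookup σ i ∧ lookup κ i)

    black-in-σ⇒black-in-σ′ : ∀ {i} → T (lookup σ i ∧ lookup ε i) → T (lookup σ i ∧ lookup ε′ i)
    black-in-σ⇒black-in-σ′ = T-∧-monoʳ black-stays-black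

    ∂h-simplex-∉ : v ∉ σ → ∂h-simplex ε′ σ ≡ ∂h-simplex ε σ
    ∂h-simplex-∉ v∉σ =
      cong (map (λ w → σ [ w ]≔ false))
        (filter-≐ (BlackIn? ε′) (BlackIn? ε) (black-in-σ′⇒black-in-σ , black-in-σ⇒black-in-σ′) (allFin m))
      where
      black-in-σ′⇒black-in-σ : ∀ {i} → T (lookup σ i ∧ lookup ε′ i) → T (lookup σ i ∧ lookup ε i)
      black-in-σ′⇒black-in-σ {i} t with i ≟ᶠ v
      ... | yes refl = ⊥-elim (v∉σ (T-lookup⇒∈ (proj₁ (Equivalence.to T-∧ t))))
      ... | no i≢v   = T-∧-monoʳ (black-was-black i≢v) t

    ∂h-simplex-∈ : v ∈ σ → ∂h-simplex ε′ σ ↭ delete v σ ∷ ∂h-simplex ε σ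
    ∂h-simplex-∈ v∈σ = ↭-trans
      (map⁺ (λ w → σ [ w ]≔ false)
        (filter-add-point _≟ᶠ_ (BlackIn? ε) (BlackIn? ε′) black-in-σ⇒black-in-σ′
          (λ i≢v → T-∧-monoʳ (black-was-black i≢v)) v-white v-black (allFin m)))
      (↭-reflexive (cong (λ vs → map (λ w → σ [ w ]≔ false) (vs ++ filter (BlackIn? ε) (allFin m)))
        (filter-≟-unique _≟ᶠ_ (allFin⁺ m) (∈-allFin v))))
      where
      v-white : ¬ T (lookup σ v ∧ lookup ε v)
      v-white t = subst T ε[v]≡false (proj₂ (Equivalence.to T-∧ t))
      v-black : T (lookup σ v ∧ lookup ε′ v)
      v-black = Equivalence.from T-∧
        (Equivalence.from T-≡ ([]=⇒lookup v∈σ) , Equivalence.from T-≡ ε′[v]≡true)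

  ∂h-recolour : ∀ x → ∂h ε′ x ↭ deleteVertex v x ++ ∂h ε x
  ∂h-recolour [] = ↭-refl
  ∂h-recolour (σ ∷ x) with v ∈? σ
  ... | yes v∈σ = ↭-trans (++⁺ (∂h-simplex-∈ σ v∈σ) (∂h-recolour x))
                          (prep (delete v σ) (shifts (∂h-simplex ε σ) (deleteVertex v x)))
  ... | no v∉σ  = ↭-trans (++⁺ (↭-reflexive (∂h-simplex-∉ σ v∉σ)) (∂h-recolour x))
                          (shifts (∂h-simplex ε σ) (deleteVertex v x))

  IsCycle-recolour : ∀ x → IsCycle ε x → IsCycle ε′ x ⇔ IsZero (deleteVertex v x)
  IsCycle-recolour x cyc = ⇔-trans
    (mk⇔ (IsZero-resp-↭ (∂h-recolour x)) (IsZero-resp-↭ (↭-sym (∂h-recolour x))))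
    (IsZero-++ʳ (deleteVertex v x) (∂h ε x) cyc)

lemma6p1 : ∀ {m : ℕ} (X : SimplicialComplex m) (ε ε′ : Colouring m) (v : Fin m)
    → lookup ε v ≡ false → lookup ε′ v ≡ true
    → (∀ i → i ≢ v → lookup ε i ≡ lookup ε′ i)
    → (x : Chain m) → Unique x → InComplex X x
    → Homogeneous ε x → IsCycle ε x
    → IsCycle ε′ x ⇔ (¬ Any (λ σ → v ∈ σ) x)
lemma6p1 _ ε ε′ v ε[v]≡false ε′[v]≡true agree x x-unique _ _ cyc =
  ⇔-trans (IsCycle-recolour x cyc) (IsZero-deleteVertex v x x-unique)
  where open Recolouring ε ε′ v ε[v]≡false ε′[v]≡true agree
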